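{- Let $\mathbf{n}=(n_1,\dots,n_s)\in\mathbb{N}_+^s$ and $\ell\in\{1,\dots,s\}$. Then $A_{\mathbf{n}+\mathbf{e}_\ell}=M_{\mathbf{n},\ell}A_\mathbf{n}$, where $M_{\mathbf{n},\ell}$ is the $s\times s$ matrix whose $(k,j)$ entry is $n_j+\delta_{kj}(\alpha_k-\alpha_\ell)$ (Kronecker $\delta_{kj}$), i.e. \[ M_{\mathbf{n},\ell}=\begin{pmatrix}n_1+(\alpha_1-\alpha_\ell)&n_2&\cdots&n_s\\ n_1&n_2+(\alpha_2-\alpha_\ell)&\cdots&n_s\\ \vdots&\vdots&\ddots&\vdots\\ n_1&n_2&\cdots&n_s+(\alpha_s-\alpha_\ell)\end{pmatrix}. \]
   Context: $K$ is a number field and $\alpha_1,\dots,\alpha_s\in K$ are distinct. For $\mathbf{m}\in\mathbb{N}^s$ with sum $M$: $f_\mathbf{m}(z)=\prod_i(z-\alpha_i)^{m_i}$, $P_\mathbf{m}(z)=\sum_{k=0}^Mf_\mathbf{m}^{(k)}(z)$, $a_\mathbf{m}=(P_\mathbf{m}(\alpha_1),\dots,P_\mathbf{m}(\alpha_s))$ (and $a_\mathbf{m}=0$ if $\mathbf{m}\notin\mathbb{N}^s$). $\mathbf{e}_1,\dots,\mathbf{e}_s$ is the standard basis of $\mathbb{Z}^s$. For $\mathbf{m}\in\mathbb{N}_+^s$, $A_\mathbf{m}$ is the $s\times s$ matrix whose $k$-th row is $a_{\mathbf{m}-\mathbf{e}_k}$, $k=1,\dots,s$. -}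

module Defs where

open import Level using (Level)
open import Algebra.Bundles using (CommutativeRing)
open import Data.Nat as ℕ using (ℕ; zero; suc)
open import Data.Fin using (Fin; zero; suc; _≟_)
open import Data.List using (List; []; _∷_)
open import Data.Bool using (if_then_else_)
open import Relation.Nullary using (does)

-- Univariate polynomials over a commutative ring R, represented by their
-- coefficient lists (lowest degree first), with formal derivative and evaluation.
module Poly {c ℓ : Level} (R : CommutativeRing c ℓ) where
  open CommutativeRing R hiding (zero)

  Pol : Set c
  Pol = List Carrier

  fromℕ : ℕ → Carrier
  fromℕ zero    = 0#
  fromℕ (suc n) = 1# + fromℕ n

  _⊕_ : Pol → Pol → Pol
  []      ⊕ q       = q
  (a ∷ p) ⊕ []      = a ∷ p
  (a ∷ p) ⊕ (b ∷ q) = (a + b) ∷ (p ⊕ q)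

  scale : Carrier → Pol → Pol
  scale c []      = []
  scale c (a ∷ p) = (c * a) ∷ scale c p

  _⊗_ : Pol → Pol → Pol
  []      ⊗ q = []
  (a ∷ p) ⊗ q = scale a q ⊕ (0# ∷ (p ⊗ q))

  one : Pol
  one = 1# ∷ []

  linear : Carrier → Pol
  linear α = (- α) ∷ 1# ∷ []

  pow : Pol → ℕ → Pol
  pow p zero    = one
  pow p (suc m) = p ⊗ pow p m

  derivFrom : ℕ → Pol → Pol
  derivFrom k []      = []
  derivFrom k (b ∷ p) = (fromℕ k * b) ∷ derivFrom (suc k) p

  deriv : Pol → Pol
  deriv []      = []
  deriv (a ∷ p) = derivFrom 1 p

  derivN : ℕ → Pol → Pol
  derivN zero    p = p
  derivN (suc k) p = deriv (derivN k p)

  eval : Pol → Carrier → Carrier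
  eval []      x = 0#
  eval (a ∷ p) x = a + x * eval p x

  prodFin : (s : ℕ) → (Fin s → Pol) → Pol
  prodFin zero    g = one
  prodFin (suc s) g = g zero ⊗ prodFin s (λ i → g (suc i))

  sumFin : (s : ℕ) → (Fin s → Carrier) → Carrier
  sumFin zero    g = 0#
  sumFin (suc s) g = g zero + sumFin s (λ i → g (suc i))

  sumℕ : (s : ℕ) → (Fin s → ℕ) → ℕ
  sumℕ zero    g = 0
  sumℕ (suc s) g = g zero ℕ.+ sumℕ s (λ i → g (suc i))

  sumUpTo : ℕ → (ℕ → Pol) → Pol
  sumUpTo zero    g = g zero
  sumUpTo (suc M) g = sumUpTo M g ⊕ g (suc M)

  module _ {s : ℕ} (α : Fin s → Carrier) where

    f : (Fin s → ℕ) → Pol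
    f m = prodFin s (λ i → pow (linear (α i)) (m i))

    P : (Fin s → ℕ) → Pol
    P m = sumUpTo (sumℕ s m) (λ k → derivN k (f m))

    a : (Fin s → ℕ) → Fin s → Carrier
    a m j = eval (P m) (α j)

    -- m - e_k (only used for m with all entries ≥ 1, where it lies in ℕ^s)
    minusE : (Fin s → ℕ) → Fin s → Fin s → ℕ
    minusE m k i = if does (i ≟ k) then m i ℕ.∸ 1 else m i

    plusE : (Fin s → ℕ) → Fin s → Fin s → ℕ
    plusE m k i = if does (i ≟ k) then suc (m i) else m i

    A : (Fin s → ℕ) → Fin s → Fin s → Carrier
    A m k j = a (minusE m k) j

    δ : Fin s → Fin s → Carrier
    δ k j = if does (k ≟ j) then 1# else 0#

    Mat : (Fin s → ℕ) → Fin s → Fin s → Fin s → Carrier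
    Mat n ℓ' k j = fromℕ (n j) + δ k j * (α k - α ℓ')

  matMul : {s : ℕ} → (Fin s → Fin s → Carrier) → (Fin s → Fin s → Carrier)
         → Fin s → Fin s → Carrier
  matMul {s} X Y k j = sumFin s (λ i → X k i * Y i j)

{-# OPTIONS --safe #-}
-- Write |m| = Σᵢ mᵢ, so that P_m = Σ_{k ≤ |m|} f_m^(k).  Since f_m′ = Σᵢ mᵢ f_{m-eᵢ},
-- peeling off the k = 0 term gives P_n = f_n + Σᵢ nᵢ P_{n-eᵢ}; as f_n vanishes at every αⱼ,
-- a_n = Σᵢ nᵢ a_{n-eᵢ}.  On the other hand (z - αₗ) f_{n-eₖ} = f_n + (αₖ - αₗ) f_{n-eₖ}, and
-- f_{n-eₖ} has degree |n| - 1, so its derivative of order |n| vanishes; hence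
-- a_{n+eₗ-eₖ} = a_n + (αₖ - αₗ) a_{n-eₖ}.  Substituting the first
-- identity into the second expresses row k of A_{n+eₗ} as Σᵢ (nᵢ + δₖᵢ (αₖ - αₗ)) a_{n-eᵢ}.
module Submission where

open import Defs
open import Level using (Level)
open import Algebra.Bundles using (CommutativeRing)
open import Data.Nat using (ℕ; zero; suc; _≤_; _∸_; _⊔_; s≤s)
import Data.Nat as ℕ
import Data.Nat.Properties as ℕ
open import Data.Fin using (Fin; zero; suc; _≟_)
open import Data.List using ([]; _∷_; length; drop)
open import Relation.Nullary using (¬_; yes; no)
open import Relation.Binary.Bundles using (Setoid)
open import Relation.Binary.PropositionalEquality as ≡ using (_≡_; _≢_)
import Relation.Binary.Reasoning.Setoid as SetoidReasoning
import Algebra.Solver.Ring.NaturalCoefficients.Default as RingSolver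
import Algebra.Properties.Semiring.Sum as SemiringSum

module Polynomials {r ℓ : Level} (R : CommutativeRing r ℓ) where
  open CommutativeRing R hiding (zero)
  open Poly R
  open RingSolver commutativeSemiring using (solve; _:=_; _:+_; _:*_; con)
  open SemiringSum semiring using (sum; sum-cong-≋; sum-replicate-zero)

  coeff : Pol → ℕ → Carrier
  coeff []      i       = 0#
  coeff (a ∷ p) zero    = a
  coeff (a ∷ p) (suc i) = coeff p i

  coeff-suc : ∀ p i → coeff p (suc i) ≡ coeff (drop 1 p) i
  coeff-suc []      i = ≡.refl
  coeff-suc (a ∷ p) i = ≡.refl

  -- Coefficient lists are compared up to trailing zeros.
  infix 4 _≋_
  record _≋_ (p q : Pol) : Set ℓ where
    constructor mk≋
    field coeff-≈ : ∀ i → coeff p i ≈ coeff q i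
  open _≋_ public

  ≋-refl : ∀ {p} → p ≋ p
  ≋-refl = mk≋ λ i → refl

  ≋-sym : ∀ {p q} → p ≋ q → q ≋ p
  ≋-sym e = mk≋ λ i → sym (coeff-≈ e i)

  ≋-trans : ∀ {p q r} → p ≋ q → q ≋ r → p ≋ r
  ≋-trans e e′ = mk≋ λ i → trans (coeff-≈ e i) (coeff-≈ e′ i)

  ≋-reflexive : ∀ {p q} → p ≡ q → p ≋ q
  ≋-reflexive ≡.refl = ≋-refl

  ≋-setoid : Setoid r ℓ
  ≋-setoid = record
    { Carrier       = Pol
    ; _≈_           = _≋_
    ; isEquivalence = record { refl = ≋-refl ; sym = ≋-sym ; trans = ≋-trans }
    }

  module ≋-Reasoning = SetoidReasoning ≋-setoid
  module ≈-Reasoning = SetoidReasoning setoid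

  ∷-cong : ∀ {a b p q} → a ≈ b → p ≋ q → a ∷ p ≋ b ∷ q
  ∷-cong a≈b p≋q = mk≋ λ { zero → a≈b ; (suc i) → coeff-≈ p≋q i }

  drop1-cong : ∀ {p q} → p ≋ q → drop 1 p ≋ drop 1 q
  drop1-cong {p} {q} p≋q = mk≋ λ i → ≡.subst₂ _≈_ (coeff-suc p i) (coeff-suc q i) (coeff-≈ p≋q (suc i))

  coeff-⊕ : ∀ p q i → coeff (p ⊕ q) i ≈ coeff p i + coeff q i
  coeff-⊕ []      q       i       = sym (+-identityˡ _)
  coeff-⊕ (a ∷ p) []      i       = sym (+-identityʳ _)
  coeff-⊕ (a ∷ p) (b ∷ q) zero    = refl
  coeff-⊕ (a ∷ p) (b ∷ q) (suc i) = coeff-⊕ p q i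

  coeff-scale : ∀ a p i → coeff (scale a p) i ≈ a * coeff p i
  coeff-scale a []      i       = sym (zeroʳ a)
  coeff-scale a (b ∷ p) zero    = refl
  coeff-scale a (b ∷ p) (suc i) = coeff-scale a p i

  ⊕-cong : ∀ {p p′ q q′} → p ≋ p′ → q ≋ q′ → p ⊕ q ≋ p′ ⊕ q′
  ⊕-cong {p} {p′} {q} {q′} p≋p′ q≋q′ = mk≋ λ i →
    trans (coeff-⊕ p q i) (trans (+-cong (coeff-≈ p≋p′ i) (coeff-≈ q≋q′ i)) (sym (coeff-⊕ p′ q′ i)))

  ⊕-congˡ : ∀ p {q q′} → q ≋ q′ → p ⊕ q ≋ p ⊕ q′
  ⊕-congˡ p = ⊕-cong ≋-refl

  ⊕-congʳ : ∀ {p p′ q} → p ≋ p′ → p ⊕ q ≋ p′ ⊕ q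
  ⊕-congʳ p≋p′ = ⊕-cong p≋p′ ≋-refl

  ⊕-comm : ∀ p q → p ⊕ q ≋ q ⊕ p
  ⊕-comm p q = mk≋ λ i → trans (coeff-⊕ p q i) (trans (+-comm _ _) (sym (coeff-⊕ q p i)))

  ⊕-assoc : ∀ p q r → (p ⊕ q) ⊕ r ≋ p ⊕ (q ⊕ r)
  ⊕-assoc p q r = mk≋ λ i → begin
    coeff ((p ⊕ q) ⊕ r) i                ≈⟨ trans (coeff-⊕ (p ⊕ q) r i) (+-congʳ (coeff-⊕ p q i)) ⟩
    (coeff p i + coeff q i) + coeff r i  ≈⟨ +-assoc _ _ _ ⟩
    coeff p i + (coeff q i + coeff r i)  ≈⟨ sym (trans (coeff-⊕ p (q ⊕ r) i) (+-congˡ (coeff-⊕ q r i))) ⟩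
    coeff (p ⊕ (q ⊕ r)) i                ∎
    where open ≈-Reasoning

  ⊕-identityʳ : ∀ p → p ⊕ [] ≋ p
  ⊕-identityʳ []      = ≋-refl
  ⊕-identityʳ (a ∷ p) = ≋-refl

  ⊕-lcomm : ∀ p q r → p ⊕ (q ⊕ r) ≋ q ⊕ (p ⊕ r)
  ⊕-lcomm p q r = ≋-trans (≋-sym (⊕-assoc p q r)) (≋-trans (⊕-congʳ (⊕-comm p q)) (⊕-assoc q p r))

  ⊕-interchange : ∀ p q r s → (p ⊕ q) ⊕ (r ⊕ s) ≋ (p ⊕ r) ⊕ (q ⊕ s)
  ⊕-interchange p q r s =
    ≋-trans (⊕-assoc p q (r ⊕ s)) (≋-trans (⊕-congˡ p (⊕-lcomm q r s)) (≋-sym (⊕-assoc p r (q ⊕ s))))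

  scale-cong : ∀ {a b p q} → a ≈ b → p ≋ q → scale a p ≋ scale b q
  scale-cong {a} {b} {p} {q} a≈b p≋q = mk≋ λ i →
    trans (coeff-scale a p i) (trans (*-cong a≈b (coeff-≈ p≋q i)) (sym (coeff-scale b q i)))

  scale-⊕ : ∀ a p q → scale a (p ⊕ q) ≋ scale a p ⊕ scale a q
  scale-⊕ a p q = mk≋ λ i → begin
    coeff (scale a (p ⊕ q)) i                 ≈⟨ trans (coeff-scale a (p ⊕ q) i) (*-congˡ (coeff-⊕ p q i)) ⟩
    a * (coeff p i + coeff q i)               ≈⟨ distribˡ _ _ _ ⟩
    a * coeff p i + a * coeff q i             ≈⟨ sym (+-cong (coeff-scale a p i) (coeff-scale a q i)) ⟩
    coeff (scale a p) i + coeff (scale a q) i ≈⟨ sym (coeff-⊕ (scale a p) (scale a q) i) ⟩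
    coeff (scale a p ⊕ scale a q) i           ∎
    where open ≈-Reasoning

  scale-+ : ∀ a b p → scale (a + b) p ≋ scale a p ⊕ scale b p
  scale-+ a b p = mk≋ λ i → begin
    coeff (scale (a + b) p) i                 ≈⟨ trans (coeff-scale (a + b) p i) (distribʳ _ _ _) ⟩
    a * coeff p i + b * coeff p i             ≈⟨ sym (+-cong (coeff-scale a p i) (coeff-scale b p i)) ⟩
    coeff (scale a p) i + coeff (scale b p) i ≈⟨ sym (coeff-⊕ (scale a p) (scale b p) i) ⟩
    coeff (scale a p ⊕ scale b p) i           ∎
    where open ≈-Reasoning

  scale-* : ∀ a b p → scale (a * b) p ≋ scale a (scale b p)
  scale-* a b p = mk≋ λ i → begin
    coeff (scale (a * b) p) i   ≈⟨ trans (coeff-scale (a * b) p i) (*-assoc _ _ _) ⟩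
    a * (b * coeff p i)         ≈⟨ *-congˡ (sym (coeff-scale b p i)) ⟩
    a * coeff (scale b p) i     ≈⟨ sym (coeff-scale a (scale b p) i) ⟩
    coeff (scale a (scale b p)) i ∎
    where open ≈-Reasoning

  scale-0# : ∀ p → scale 0# p ≋ []
  scale-0# p = mk≋ λ i → trans (coeff-scale 0# p i) (zeroˡ _)

  scale-1# : ∀ p → scale 1# p ≋ p
  scale-1# p = mk≋ λ i → trans (coeff-scale 1# p i) (*-identityˡ _)

  shift : Pol → Pol
  shift p = 0# ∷ p

  shift-cong : ∀ {p q} → p ≋ q → shift p ≋ shift q
  shift-cong = ∷-cong refl

  shift-[] : shift [] ≋ []
  shift-[] = mk≋ λ { zero → refl ; (suc i) → refl }

  shift-⊕ : ∀ p q → shift (p ⊕ q) ≋ shift p ⊕ shift q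
  shift-⊕ p q = ∷-cong (sym (+-identityˡ 0#)) ≋-refl

  scale-shift : ∀ a p → scale a (shift p) ≋ shift (scale a p)
  scale-shift a p = ∷-cong (zeroʳ a) ≋-refl

  -- Multiplication

  coeff-⊗-zero : ∀ p q → coeff (p ⊗ q) 0 ≈ coeff p 0 * coeff q 0
  coeff-⊗-zero []      q = sym (zeroˡ _)
  coeff-⊗-zero (a ∷ p) q = trans (coeff-⊕ (scale a q) (shift (p ⊗ q)) 0) (trans (+-identityʳ _) (coeff-scale a q 0))

  coeff-⊗-suc : ∀ p q i → coeff (p ⊗ q) (suc i) ≈ coeff p 0 * coeff q (suc i) + coeff (drop 1 p ⊗ q) i
  coeff-⊗-suc []      q i = solve 1 (λ x → con 0 := con 0 :* x :+ con 0) refl (coeff q (suc i))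
  coeff-⊗-suc (a ∷ p) q i = trans (coeff-⊕ (scale a q) (shift (p ⊗ q)) (suc i)) (+-congʳ (coeff-scale a q (suc i)))

  ⊗-congˡ : ∀ {p p′} q → p ≋ p′ → p ⊗ q ≋ p′ ⊗ q
  ⊗-congˡ q p≋p′ = mk≋ (coeffs-≈ p≋p′)
    where
    coeffs-≈ : ∀ {p p′} → p ≋ p′ → ∀ i → coeff (p ⊗ q) i ≈ coeff (p′ ⊗ q) i
    coeffs-≈ {p} {p′} e zero =
      trans (coeff-⊗-zero p q) (trans (*-congʳ (coeff-≈ e 0)) (sym (coeff-⊗-zero p′ q)))
    coeffs-≈ {p} {p′} e (suc i) =
      trans (coeff-⊗-suc p q i)
        (trans (+-cong (*-congʳ (coeff-≈ e 0)) (coeffs-≈ (drop1-cong e) i)) (sym (coeff-⊗-suc p′ q i)))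

  ⊗-zeroʳ : ∀ p → p ⊗ [] ≋ []
  ⊗-zeroʳ []      = ≋-refl
  ⊗-zeroʳ (a ∷ p) = ≋-trans (shift-cong (⊗-zeroʳ p)) shift-[]

  ⊗-identityˡ : ∀ p → one ⊗ p ≋ p
  ⊗-identityˡ p = ≋-trans (⊕-cong (scale-1# p) shift-[]) (⊕-identityʳ p)

  ⊗-shiftˡ : ∀ p q → shift p ⊗ q ≋ shift (p ⊗ q)
  ⊗-shiftˡ p q = ⊕-congʳ (scale-0# q)

  ⊗-consʳ : ∀ p b q → p ⊗ (b ∷ q) ≋ scale b p ⊕ shift (p ⊗ q)
  ⊗-consʳ []      b q = ≋-sym shift-[]
  ⊗-consʳ (a ∷ p) b q = ∷-cong (+-congʳ (*-comm a b))
    (≋-trans (⊕-congˡ (scale a q) (⊗-consʳ p b q)) (⊕-lcomm (scale a q) (scale b p) (shift (p ⊗ q))))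

  ⊗-comm : ∀ p q → p ⊗ q ≋ q ⊗ p
  ⊗-comm []      q = ≋-sym (⊗-zeroʳ q)
  ⊗-comm (a ∷ p) q = ≋-trans (⊕-congˡ (scale a q) (shift-cong (⊗-comm p q))) (≋-sym (⊗-consʳ q a p))

  ⊗-congʳ : ∀ p {q q′} → q ≋ q′ → p ⊗ q ≋ p ⊗ q′
  ⊗-congʳ p {q} {q′} q≋q′ = ≋-trans (⊗-comm p q) (≋-trans (⊗-congˡ p q≋q′) (⊗-comm q′ p))

  ⊗-scaleˡ : ∀ a p q → scale a p ⊗ q ≋ scale a (p ⊗ q)
  ⊗-scaleˡ a []      q = ≋-refl
  ⊗-scaleˡ a (b ∷ p) q = begin
    scale (a * b) q ⊕ shift (scale a p ⊗ q)     ≈⟨ ⊕-cong (scale-* a b q) (shift-cong (⊗-scaleˡ a p q)) ⟩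
    scale a (scale b q) ⊕ shift (scale a (p ⊗ q)) ≈⟨ ⊕-congˡ (scale a (scale b q)) (≋-sym (scale-shift a (p ⊗ q))) ⟩
    scale a (scale b q) ⊕ scale a (shift (p ⊗ q)) ≈⟨ ≋-sym (scale-⊕ a (scale b q) (shift (p ⊗ q))) ⟩
    scale a (scale b q ⊕ shift (p ⊗ q))           ∎
    where open ≋-Reasoning

  ⊗-scaleʳ : ∀ a p q → p ⊗ scale a q ≋ scale a (p ⊗ q)
  ⊗-scaleʳ a p q = ≋-trans (⊗-comm p (scale a q)) (≋-trans (⊗-scaleˡ a q p) (scale-cong refl (⊗-comm q p)))

  ⊗-distribʳ : ∀ p q r → (p ⊕ q) ⊗ r ≋ (p ⊗ r) ⊕ (q ⊗ r)
  ⊗-distribʳ []      q       r = ≋-refl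
  ⊗-distribʳ (a ∷ p) []      r = ≋-sym (⊕-identityʳ _)
  ⊗-distribʳ (a ∷ p) (b ∷ q) r = begin
    scale (a + b) r ⊕ shift ((p ⊕ q) ⊗ r)
      ≈⟨ ⊕-cong (scale-+ a b r) (≋-trans (shift-cong (⊗-distribʳ p q r)) (shift-⊕ (p ⊗ r) (q ⊗ r))) ⟩
    (scale a r ⊕ scale b r) ⊕ (shift (p ⊗ r) ⊕ shift (q ⊗ r))
      ≈⟨ ⊕-interchange (scale a r) (scale b r) (shift (p ⊗ r)) (shift (q ⊗ r)) ⟩
    (scale a r ⊕ shift (p ⊗ r)) ⊕ (scale b r ⊕ shift (q ⊗ r))
      ∎
    where open ≋-Reasoning

  ⊗-distribˡ : ∀ p q r → p ⊗ (q ⊕ r) ≋ (p ⊗ q) ⊕ (p ⊗ r)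
  ⊗-distribˡ p q r =
    ≋-trans (⊗-comm p (q ⊕ r)) (≋-trans (⊗-distribʳ q r p) (⊕-cong (⊗-comm q p) (⊗-comm r p)))

  ⊗-assoc : ∀ p q r → (p ⊗ q) ⊗ r ≋ p ⊗ (q ⊗ r)
  ⊗-assoc []      q r = ≋-refl
  ⊗-assoc (a ∷ p) q r = begin
    (scale a q ⊕ shift (p ⊗ q)) ⊗ r           ≈⟨ ⊗-distribʳ (scale a q) (shift (p ⊗ q)) r ⟩
    (scale a q ⊗ r) ⊕ (shift (p ⊗ q) ⊗ r)     ≈⟨ ⊕-cong (⊗-scaleˡ a q r) (⊗-shiftˡ (p ⊗ q) r) ⟩
    scale a (q ⊗ r) ⊕ shift ((p ⊗ q) ⊗ r)     ≈⟨ ⊕-congˡ (scale a (q ⊗ r)) (shift-cong (⊗-assoc p q r)) ⟩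
    scale a (q ⊗ r) ⊕ shift (p ⊗ (q ⊗ r))     ∎
    where open ≋-Reasoning

  constant-⊗ : ∀ a p → (a ∷ []) ⊗ p ≋ scale a p
  constant-⊗ a p = ≋-trans (⊕-congˡ (scale a p) shift-[]) (⊕-identityʳ _)

  linear-change-root : ∀ a b → linear b ≋ linear a ⊕ ((a - b) ∷ [])
  linear-change-root a b = ∷-cong
    (sym (trans (sym (+-assoc (- a) a (- b))) (trans (+-congʳ (-‿inverseˡ a)) (+-identityˡ (- b))))) ≋-refl

  -- Differentiation

  coeff-derivFrom : ∀ k p i → coeff (derivFrom k p) i ≈ fromℕ (i ℕ.+ k) * coeff p i
  coeff-derivFrom k []      i       = sym (zeroʳ _)
  coeff-derivFrom k (b ∷ p) zero    = refl
  coeff-derivFrom k (b ∷ p) (suc i) =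
    trans (coeff-derivFrom (suc k) p i) (*-congʳ (reflexive (≡.cong fromℕ (ℕ.+-suc i k))))

  coeff-deriv : ∀ p i → coeff (deriv p) i ≈ fromℕ (suc i) * coeff p (suc i)
  coeff-deriv []      i = sym (zeroʳ _)
  coeff-deriv (a ∷ p) i = trans (coeff-derivFrom 1 p i) (*-congʳ (reflexive (≡.cong fromℕ (ℕ.+-comm i 1))))

  deriv-cong : ∀ {p q} → p ≋ q → deriv p ≋ deriv q
  deriv-cong {p} {q} p≋q = mk≋ λ i →
    trans (coeff-deriv p i) (trans (*-congˡ (coeff-≈ p≋q (suc i))) (sym (coeff-deriv q i)))

  deriv-⊕ : ∀ p q → deriv (p ⊕ q) ≋ deriv p ⊕ deriv q
  deriv-⊕ p q = mk≋ λ i → begin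
    coeff (deriv (p ⊕ q)) i
      ≈⟨ trans (coeff-deriv (p ⊕ q) i) (*-congˡ (coeff-⊕ p q (suc i))) ⟩
    fromℕ (suc i) * (coeff p (suc i) + coeff q (suc i))
      ≈⟨ distribˡ _ _ _ ⟩
    fromℕ (suc i) * coeff p (suc i) + fromℕ (suc i) * coeff q (suc i)
      ≈⟨ sym (trans (coeff-⊕ (deriv p) (deriv q) i) (+-cong (coeff-deriv p i) (coeff-deriv q i))) ⟩
    coeff (deriv p ⊕ deriv q) i
      ∎
    where open ≈-Reasoning

  deriv-scale : ∀ a p → deriv (scale a p) ≋ scale a (deriv p)
  deriv-scale a p = mk≋ λ i → begin
    coeff (deriv (scale a p)) i
      ≈⟨ trans (coeff-deriv (scale a p) i) (*-congˡ (coeff-scale a p (suc i))) ⟩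
    fromℕ (suc i) * (a * coeff p (suc i))
      ≈⟨ solve 3 (λ n a x → n :* (a :* x) := a :* (n :* x)) refl (fromℕ (suc i)) a (coeff p (suc i)) ⟩
    a * (fromℕ (suc i) * coeff p (suc i))
      ≈⟨ sym (trans (coeff-scale a (deriv p) i) (*-congˡ (coeff-deriv p i))) ⟩
    coeff (scale a (deriv p)) i
      ∎
    where open ≈-Reasoning

  -- a ∷ p is a + z·p, so this is the product rule for z·p.
  deriv-∷ : ∀ a p → deriv (a ∷ p) ≋ p ⊕ shift (deriv p)
  deriv-∷ a p = mk≋ λ
    { zero → begin
        coeff (deriv (a ∷ p)) 0       ≈⟨ coeff-deriv (a ∷ p) 0 ⟩
        (1# + 0#) * coeff p 0         ≈⟨ solve 1 (λ x → (con 1 :+ con 0) :* x := x :+ con 0) refl (coeff p 0) ⟩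
        coeff p 0 + 0#                ≈⟨ sym (coeff-⊕ p (shift (deriv p)) 0) ⟩
        coeff (p ⊕ shift (deriv p)) 0 ∎
    ; (suc i) → begin
        coeff (deriv (a ∷ p)) (suc i)
          ≈⟨ coeff-deriv (a ∷ p) (suc i) ⟩
        (1# + fromℕ (suc i)) * coeff p (suc i)
          ≈⟨ solve 2 (λ n x → (con 1 :+ n) :* x := x :+ n :* x) refl (fromℕ (suc i)) (coeff p (suc i)) ⟩
        coeff p (suc i) + fromℕ (suc i) * coeff p (suc i)
          ≈⟨ sym (trans (coeff-⊕ p (shift (deriv p)) (suc i)) (+-congˡ (coeff-deriv p i))) ⟩
        coeff (p ⊕ shift (deriv p)) (suc i)
          ∎ }
    where open ≈-Reasoning

  deriv-⊗ : ∀ p q → deriv (p ⊗ q) ≋ (deriv p ⊗ q) ⊕ (p ⊗ deriv q)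
  deriv-⊗ []      q = ≋-refl
  deriv-⊗ (a ∷ p) q = begin
    deriv (scale a q ⊕ shift (p ⊗ q))
      ≈⟨ deriv-⊕ (scale a q) (shift (p ⊗ q)) ⟩
    deriv (scale a q) ⊕ deriv (shift (p ⊗ q))
      ≈⟨ ⊕-cong (deriv-scale a q) (≋-trans (deriv-∷ 0# (p ⊗ q)) (⊕-congˡ (p ⊗ q) (shift-cong (deriv-⊗ p q)))) ⟩
    scale a (deriv q) ⊕ ((p ⊗ q) ⊕ shift ((deriv p ⊗ q) ⊕ (p ⊗ deriv q)))
      ≈⟨ ⊕-congˡ (scale a (deriv q)) (⊕-congˡ (p ⊗ q) (shift-⊕ (deriv p ⊗ q) (p ⊗ deriv q))) ⟩
    scale a (deriv q) ⊕ ((p ⊗ q) ⊕ (shift (deriv p ⊗ q) ⊕ shift (p ⊗ deriv q)))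
      ≈⟨ ⊕-congˡ (scale a (deriv q)) (≋-sym (⊕-assoc (p ⊗ q) (shift (deriv p ⊗ q)) (shift (p ⊗ deriv q)))) ⟩
    scale a (deriv q) ⊕ (((p ⊗ q) ⊕ shift (deriv p ⊗ q)) ⊕ shift (p ⊗ deriv q))
      ≈⟨ ⊕-lcomm (scale a (deriv q)) ((p ⊗ q) ⊕ shift (deriv p ⊗ q)) (shift (p ⊗ deriv q)) ⟩
    ((p ⊗ q) ⊕ shift (deriv p ⊗ q)) ⊕ (scale a (deriv q) ⊕ shift (p ⊗ deriv q))
      ≈⟨ ⊕-congʳ (≋-sym (≋-trans (⊗-congˡ q (deriv-∷ a p)) (≋-trans (⊗-distribʳ p (shift (deriv p)) q)
                                                             (⊕-congˡ (p ⊗ q) (⊗-shiftˡ (deriv p) q))))) ⟩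
    (deriv (a ∷ p) ⊗ q) ⊕ (scale a (deriv q) ⊕ shift (p ⊗ deriv q))
      ∎
    where open ≋-Reasoning

  deriv-linear : ∀ a → deriv (linear a) ≋ one
  deriv-linear a = ∷-cong (solve 0 ((con 1 :+ con 0) :* con 1 := con 1) refl) ≋-refl

  deriv-pow-linear : ∀ a k → deriv (pow (linear a) k) ≋ scale (fromℕ k) (pow (linear a) (k ∸ 1))
  deriv-pow-linear a zero    = ≋-sym (scale-0# one)
  deriv-pow-linear a (suc k) = begin
    deriv (linear a ⊗ X)
      ≈⟨ deriv-⊗ (linear a) X ⟩
    (deriv (linear a) ⊗ X) ⊕ (linear a ⊗ deriv X)
      ≈⟨ ⊕-cong (≋-trans (⊗-congˡ X (deriv-linear a)) (⊗-identityˡ X))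
                (≋-trans (⊗-congʳ (linear a) (deriv-pow-linear a k)) (linear-⊗-lowered k)) ⟩
    X ⊕ scale (fromℕ k) X
      ≈⟨ ≋-sym (≋-trans (scale-+ 1# (fromℕ k) X) (⊕-congʳ (scale-1# X))) ⟩
    scale (1# + fromℕ k) X
      ∎
    where
    open ≋-Reasoning
    X : Pol
    X = pow (linear a) k
    linear-⊗-lowered : ∀ k → linear a ⊗ scale (fromℕ k) (pow (linear a) (k ∸ 1)) ≋ scale (fromℕ k) (pow (linear a) k)
    linear-⊗-lowered zero    =
      ≋-trans (⊗-congʳ (linear a) (scale-0# one)) (≋-trans (⊗-zeroʳ (linear a)) (≋-sym (scale-0# one)))
    linear-⊗-lowered (suc k) = ⊗-scaleʳ (fromℕ (suc k)) (linear a) (pow (linear a) k)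

  -- Evaluation

  eval-⊕ : ∀ p q x → eval (p ⊕ q) x ≈ eval p x + eval q x
  eval-⊕ []      q       x = sym (+-identityˡ _)
  eval-⊕ (a ∷ p) []      x = sym (+-identityʳ _)
  eval-⊕ (a ∷ p) (b ∷ q) x = trans (+-congˡ (*-congˡ (eval-⊕ p q x)))
    (solve 5 (λ a b x P Q → (a :+ b) :+ x :* (P :+ Q) := (a :+ x :* P) :+ (b :+ x :* Q)) refl a b x (eval p x) (eval q x))

  eval-scale : ∀ a p x → eval (scale a p) x ≈ a * eval p x
  eval-scale a []      x = sym (zeroʳ a)
  eval-scale a (b ∷ p) x = trans (+-congˡ (*-congˡ (eval-scale a p x)))
    (solve 4 (λ a b x P → a :* b :+ x :* (a :* P) := a :* (b :+ x :* P)) refl a b x (eval p x))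

  eval-⊗ : ∀ p q x → eval (p ⊗ q) x ≈ eval p x * eval q x
  eval-⊗ []      q x = sym (zeroˡ _)
  eval-⊗ (a ∷ p) q x = begin
    eval (scale a q ⊕ shift (p ⊗ q)) x       ≈⟨ eval-⊕ (scale a q) (shift (p ⊗ q)) x ⟩
    eval (scale a q) x + (0# + x * eval (p ⊗ q) x)
      ≈⟨ +-cong (eval-scale a q x) (+-congˡ (*-congˡ (eval-⊗ p q x))) ⟩
    a * eval q x + (0# + x * (eval p x * eval q x))
      ≈⟨ solve 4 (λ a x P Q → a :* Q :+ (con 0 :+ x :* (P :* Q)) := (a :+ x :* P) :* Q) refl a x (eval p x) (eval q x) ⟩
    (a + x * eval p x) * eval q x            ∎
    where open ≈-Reasoning

  eval-[]≋ : ∀ p x → p ≋ [] → eval p x ≈ 0#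
  eval-[]≋ []      x p≋[] = refl
  eval-[]≋ (a ∷ p) x p≋[] = trans (+-cong (coeff-≈ p≋[] 0) (*-congˡ (eval-[]≋ p x (drop1-cong p≋[]))))
    (solve 1 (λ x → con 0 :+ x :* con 0 := con 0) refl x)

  eval-cong : ∀ {p q} x → p ≋ q → eval p x ≈ eval q x
  eval-cong {[]}    {[]}    x p≋q = refl
  eval-cong {[]}    {b ∷ q} x p≋q = sym (eval-[]≋ (b ∷ q) x (≋-sym p≋q))
  eval-cong {a ∷ p} {[]}    x p≋q = eval-[]≋ (a ∷ p) x p≋q
  eval-cong {a ∷ p} {b ∷ q} x p≋q = +-cong (coeff-≈ p≋q 0) (*-congˡ (eval-cong {p} {q} x (drop1-cong p≋q)))

  eval-linear-root : ∀ a → eval (linear a) a ≈ 0#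
  eval-linear-root a = trans (solve 2 (λ y a → y :+ a :* (con 1 :+ a :* con 0) := y :+ a) refl (- a) a) (-‿inverseˡ a)

  -- Finite sums in R

  sumFin≡sum : ∀ s (X : Fin s → Carrier) → sumFin s X ≡ sum X
  sumFin≡sum zero    X = ≡.refl
  sumFin≡sum (suc s) X = ≡.cong (X zero +_) (sumFin≡sum s (λ i → X (suc i)))

  sum-δ : ∀ {s} (α : Fin s → Carrier) k (X : Fin s → Carrier) → sum (λ i → δ α k i * X i) ≈ X k
  sum-δ {suc s} α zero    X = trans (+-cong (*-identityˡ (X zero)) sum-0#*) (+-identityʳ (X zero))
    where
    sum-0#* : sum (λ i → 0# * X (suc i)) ≈ 0#
    sum-0#* = trans (sum-cong-≋ (λ i → zeroˡ (X (suc i)))) (sum-replicate-zero s)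
  sum-δ {suc s} α (suc k) X =
    trans (+-cong (zeroˡ (X zero)) (sum-δ (λ i → α (suc i)) k (λ i → X (suc i)))) (+-identityˡ (X (suc k)))

  -- Sums of derivatives

  sumUpTo-cong : ∀ N {g h} → (∀ k → g k ≋ h k) → sumUpTo N g ≋ sumUpTo N h
  sumUpTo-cong zero    g≋h = g≋h zero
  sumUpTo-cong (suc N) g≋h = ⊕-cong (sumUpTo-cong N g≋h) (g≋h (suc N))

  sumUpTo-⊕ : ∀ N g h → sumUpTo N (λ k → g k ⊕ h k) ≋ sumUpTo N g ⊕ sumUpTo N h
  sumUpTo-⊕ zero    g h = ≋-refl
  sumUpTo-⊕ (suc N) g h = ≋-trans (⊕-congʳ (sumUpTo-⊕ N g h))
    (⊕-interchange (sumUpTo N g) (sumUpTo N h) (g (suc N)) (h (suc N)))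

  sumUpTo-scale : ∀ N a g → sumUpTo N (λ k → scale a (g k)) ≋ scale a (sumUpTo N g)
  sumUpTo-scale zero    a g = ≋-refl
  sumUpTo-scale (suc N) a g = ≋-trans (⊕-congʳ (sumUpTo-scale N a g)) (≋-sym (scale-⊕ a (sumUpTo N g) (g (suc N))))

  sumUpTo-suc : ∀ N g → sumUpTo (suc N) g ≋ g zero ⊕ sumUpTo N (λ k → g (suc k))
  sumUpTo-suc zero    g = ≋-refl
  sumUpTo-suc (suc N) g = ≋-trans (⊕-congʳ (sumUpTo-suc N g)) (⊕-assoc (g zero) (sumUpTo N (λ k → g (suc k))) (g (suc (suc N))))

  derivN-cong : ∀ k {p q} → p ≋ q → derivN k p ≋ derivN k q
  derivN-cong zero    p≋q = p≋q
  derivN-cong (suc k) p≋q = deriv-cong (derivN-cong k p≋q)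

  derivN-⊕ : ∀ k p q → derivN k (p ⊕ q) ≋ derivN k p ⊕ derivN k q
  derivN-⊕ zero    p q = ≋-refl
  derivN-⊕ (suc k) p q = ≋-trans (deriv-cong (derivN-⊕ k p q)) (deriv-⊕ (derivN k p) (derivN k q))

  derivN-scale : ∀ k a p → derivN k (scale a p) ≋ scale a (derivN k p)
  derivN-scale zero    a p = ≋-refl
  derivN-scale (suc k) a p = ≋-trans (deriv-cong (derivN-scale k a p)) (deriv-scale a (derivN k p))

  derivN-deriv : ∀ k p → derivN k (deriv p) ≡ derivN (suc k) p
  derivN-deriv zero    p = ≡.refl
  derivN-deriv (suc k) p = ≡.cong deriv (derivN-deriv k p)

  derivN-[] : ∀ k → derivN k [] ≡ []
  derivN-[] zero    = ≡.refl
  derivN-[] (suc k) = ≡.cong deriv (derivN-[] k)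

  derivSum : ℕ → Pol → Pol
  derivSum N p = sumUpTo N (λ k → derivN k p)

  derivSum-cong : ∀ N {p q} → p ≋ q → derivSum N p ≋ derivSum N q
  derivSum-cong N p≋q = sumUpTo-cong N (λ k → derivN-cong k p≋q)

  derivSum-⊕ : ∀ N p q → derivSum N (p ⊕ q) ≋ derivSum N p ⊕ derivSum N q
  derivSum-⊕ N p q = ≋-trans (sumUpTo-cong N (λ k → derivN-⊕ k p q)) (sumUpTo-⊕ N _ _)

  derivSum-scale : ∀ N a p → derivSum N (scale a p) ≋ scale a (derivSum N p)
  derivSum-scale N a p = ≋-trans (sumUpTo-cong N (λ k → derivN-scale k a p)) (sumUpTo-scale N a _)

  derivSum-suc : ∀ N p → derivSum (suc N) p ≋ p ⊕ derivSum N (deriv p)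
  derivSum-suc N p = ≋-trans (sumUpTo-suc N _) (⊕-congˡ p (sumUpTo-cong N (λ k → ≋-reflexive (≡.sym (derivN-deriv k p)))))

  derivSum-[] : ∀ N → derivSum N [] ≋ []
  derivSum-[] zero    = ≋-refl
  derivSum-[] (suc N) = ⊕-cong (derivSum-[] N) (≋-reflexive (derivN-[] (suc N)))

  sumPol : (s : ℕ) → (Fin s → Pol) → Pol
  sumPol zero    G = []
  sumPol (suc s) G = G zero ⊕ sumPol s (λ i → G (suc i))

  sumPol-cong : ∀ s {G H} → (∀ i → G i ≋ H i) → sumPol s G ≋ sumPol s H
  sumPol-cong zero    G≋H = ≋-refl
  sumPol-cong (suc s) G≋H = ⊕-cong (G≋H zero) (sumPol-cong s (λ i → G≋H (suc i)))

  derivSum-sumPol : ∀ N s G → derivSum N (sumPol s G) ≋ sumPol s (λ i → derivSum N (G i))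
  derivSum-sumPol N zero    G = derivSum-[] N
  derivSum-sumPol N (suc s) G =
    ≋-trans (derivSum-⊕ N _ _) (⊕-congˡ (derivSum N (G zero)) (derivSum-sumPol N s (λ i → G (suc i))))

  ⊗-sumPol : ∀ p s G → p ⊗ sumPol s G ≋ sumPol s (λ i → p ⊗ G i)
  ⊗-sumPol p zero    G = ⊗-zeroʳ p
  ⊗-sumPol p (suc s) G = ≋-trans (⊗-distribˡ p _ _) (⊕-congˡ (p ⊗ G zero) (⊗-sumPol p s (λ i → G (suc i))))

  eval-sumPol : ∀ s G x → eval (sumPol s G) x ≈ sum (λ i → eval (G i) x)
  eval-sumPol zero    G x = refl
  eval-sumPol (suc s) G x =
    trans (eval-⊕ (G zero) (sumPol s (λ i → G (suc i))) x) (+-congˡ (eval-sumPol s (λ i → G (suc i)) x))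

  -- Lengths and truncation

  length-⊕ : ∀ p q → length (p ⊕ q) ≡ length p ⊔ length q
  length-⊕ []      q       = ≡.refl
  length-⊕ (a ∷ p) []      = ≡.refl
  length-⊕ (a ∷ p) (b ∷ q) = ≡.cong suc (length-⊕ p q)

  length-scale : ∀ a p → length (scale a p) ≡ length p
  length-scale a []      = ≡.refl
  length-scale a (b ∷ p) = ≡.cong suc (length-scale a p)

  length-⊗ : ∀ p q {m n} → length p ≡ suc m → length q ≡ suc n → length (p ⊗ q) ≡ suc (m ℕ.+ n)
  length-⊗ (a ∷ []) q {n = n} ≡.refl ∣q∣ = begin
    length (scale a q ⊕ shift [])  ≡⟨ length-⊕ (scale a q) (shift []) ⟩
    length (scale a q) ⊔ 1         ≡⟨ ≡.cong (_⊔ 1) (≡.trans (length-scale a q) ∣q∣) ⟩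
    suc (n ⊔ 0)                    ≡⟨ ≡.cong suc (ℕ.⊔-identityʳ n) ⟩
    suc n                          ∎
    where open ≡.≡-Reasoning
  length-⊗ (a ∷ b ∷ p) q {n = n} ≡.refl ∣q∣ = begin
    length (scale a q ⊕ shift ((b ∷ p) ⊗ q))       ≡⟨ length-⊕ (scale a q) (shift ((b ∷ p) ⊗ q)) ⟩
    length (scale a q) ⊔ suc (length ((b ∷ p) ⊗ q)) ≡⟨ ≡.cong₂ (λ u v → u ⊔ suc v) (≡.trans (length-scale a q) ∣q∣)
                                                                (length-⊗ (b ∷ p) q ≡.refl ∣q∣) ⟩
    suc n ⊔ suc (suc (length p ℕ.+ n))              ≡⟨ ℕ.m≤n⇒m⊔n≡n (s≤s (ℕ.m≤n+m n (suc (length p)))) ⟩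
    suc (suc (length p ℕ.+ n))                      ∎
    where open ≡.≡-Reasoning

  length-pow-linear : ∀ a k → length (pow (linear a) k) ≡ suc k
  length-pow-linear a zero    = ≡.refl
  length-pow-linear a (suc k) = length-⊗ (linear a) (pow (linear a) k) ≡.refl (length-pow-linear a k)

  length-derivFrom : ∀ k p → length (derivFrom k p) ≡ length p
  length-derivFrom k []      = ≡.refl
  length-derivFrom k (b ∷ p) = ≡.cong suc (length-derivFrom (suc k) p)

  length-deriv : ∀ p → length (deriv p) ≡ length p ∸ 1
  length-deriv []      = ≡.refl
  length-deriv (a ∷ p) = length-derivFrom 1 p

  length-derivN : ∀ k p → length (derivN k p) ≡ length p ∸ k
  length-derivN zero    p = ≡.refl
  length-derivN (suc k) p = begin
    length (derivN (suc k) p)  ≡⟨ ≡.cong length (derivN-deriv k p) ⟨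
    length (derivN k (deriv p)) ≡⟨ length-derivN k (deriv p) ⟩
    length (deriv p) ∸ k       ≡⟨ ≡.cong (_∸ k) (length-deriv p) ⟩
    length p ∸ 1 ∸ k           ≡⟨ ℕ.∸-+-assoc (length p) 1 k ⟩
    length p ∸ suc k           ∎
    where open ≡.≡-Reasoning

  derivN-vanishes : ∀ k p → length p ≤ k → derivN k p ≡ []
  derivN-vanishes k p ∣p∣≤k = length≡0⇒[] (derivN k p) (≡.trans (length-derivN k p) (ℕ.m≤n⇒m∸n≡0 ∣p∣≤k))
    where
    length≡0⇒[] : ∀ (q : Pol) → length q ≡ 0 → q ≡ []
    length≡0⇒[] [] _ = ≡.refl

  derivSum-truncate : ∀ N p → length p ≤ suc N → derivSum (suc N) p ≋ derivSum N p
  derivSum-truncate N p ∣p∣≤1+N =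
    ≋-trans (⊕-congˡ (derivSum N p) (≋-reflexive (derivN-vanishes (suc N) p ∣p∣≤1+N))) (⊕-identityʳ _)

  -- Exponent vectors and the polynomials f_m

  sumℕ-cong : ∀ s {m m′} → (∀ i → m i ≡ m′ i) → sumℕ s m ≡ sumℕ s m′
  sumℕ-cong zero    m≗m′ = ≡.refl
  sumℕ-cong (suc s) m≗m′ = ≡.cong₂ ℕ._+_ (m≗m′ zero) (sumℕ-cong s (λ i → m≗m′ (suc i)))

  sumℕ-plusE : ∀ {s} (α : Fin s → Carrier) m l → sumℕ s (plusE α m l) ≡ suc (sumℕ s m)
  sumℕ-plusE α m zero    = ≡.refl
  sumℕ-plusE α m (suc l) =
    ≡.trans (≡.cong (m zero ℕ.+_) (sumℕ-plusE (λ i → α (suc i)) (λ i → m (suc i)) l)) (ℕ.+-suc (m zero) _)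

  plusE-minusE : ∀ {s} (α : Fin s → Carrier) m k → 1 ≤ m k → ∀ i → plusE α (minusE α m k) k i ≡ m i
  plusE-minusE α m k 1≤mₖ i with i ≟ k
  ... | yes ≡.refl = ℕ.suc-pred (m k) {{ℕ.>-nonZero 1≤mₖ}}
  ... | no _       = ≡.refl

  minusE-plusE : ∀ {s} (α : Fin s → Carrier) m k l → 1 ≤ m k →
                 ∀ i → minusE α (plusE α m l) k i ≡ plusE α (minusE α m k) l i
  minusE-plusE α m k l 1≤mₖ i with i ≟ k | i ≟ l
  ... | yes ≡.refl | yes ≡.refl = ≡.sym (ℕ.suc-pred (m k) {{ℕ.>-nonZero 1≤mₖ}})
  ... | yes ≡.refl | no _       = ≡.refl
  ... | no _       | yes ≡.refl = ≡.refl
  ... | no _       | no _       = ≡.refl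

  sumℕ-minusE : ∀ {s} (α : Fin s → Carrier) m k → 1 ≤ m k → suc (sumℕ s (minusE α m k)) ≡ sumℕ s m
  sumℕ-minusE {s} α m k 1≤mₖ =
    ≡.trans (≡.sym (sumℕ-plusE α (minusE α m k) k)) (sumℕ-cong s (plusE-minusE α m k 1≤mₖ))

  f-cong : ∀ {s} (α : Fin s → Carrier) {m m′} → (∀ i → m i ≡ m′ i) → f α m ≡ f α m′
  f-cong {zero}  α m≗m′ = ≡.refl
  f-cong {suc s} α m≗m′ =
    ≡.cong₂ _⊗_ (≡.cong (pow (linear (α zero))) (m≗m′ zero)) (f-cong (λ i → α (suc i)) (λ i → m≗m′ (suc i)))

  a-cong : ∀ {s} (α : Fin s → Carrier) {m m′} → (∀ i → m i ≡ m′ i) → ∀ j → a α m j ≡ a α m′ j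
  a-cong {s} α m≗m′ j =
    ≡.cong₂ (λ N p → eval (derivSum N p) (α j)) (sumℕ-cong s m≗m′) (f-cong α m≗m′)

  length-f : ∀ {s} (α : Fin s → Carrier) m → length (f α m) ≡ suc (sumℕ s m)
  length-f {zero}  α m = ≡.refl
  length-f {suc s} α m =
    length-⊗ (pow (linear (α zero)) (m zero)) _ (length-pow-linear (α zero) (m zero))
             (length-f (λ i → α (suc i)) (λ i → m (suc i)))

  f-plusE : ∀ {s} (α : Fin s → Carrier) m l → f α (plusE α m l) ≋ linear (α l) ⊗ f α m
  f-plusE α m zero    = ⊗-assoc (linear (α zero)) (pow (linear (α zero)) (m zero)) _
  f-plusE {suc s} α m (suc l) = begin
    g ⊗ f α′ (plusE α′ m′ l)   ≈⟨ ⊗-congʳ g (f-plusE α′ m′ l) ⟩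
    g ⊗ (L ⊗ f α′ m′)          ≈⟨ ≋-sym (⊗-assoc g L (f α′ m′)) ⟩
    (g ⊗ L) ⊗ f α′ m′          ≈⟨ ⊗-congˡ (f α′ m′) (⊗-comm g L) ⟩
    (L ⊗ g) ⊗ f α′ m′          ≈⟨ ⊗-assoc L g (f α′ m′) ⟩
    L ⊗ (g ⊗ f α′ m′)          ∎
    where
    open ≋-Reasoning
    α′ : Fin s → Carrier
    α′ i = α (suc i)
    m′ : Fin s → ℕ
    m′ i = m (suc i)
    g L : Pol
    g = pow (linear (α zero)) (m zero)
    L = linear (α (suc l))

  f-factor : ∀ {s} (α : Fin s → Carrier) m k → 1 ≤ m k → f α m ≋ linear (α k) ⊗ f α (minusE α m k)
  f-factor α m k 1≤mₖ =
    ≋-trans (≋-reflexive (f-cong α (λ i → ≡.sym (plusE-minusE α m k 1≤mₖ i)))) (f-plusE α (minusE α m k) k)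

  f-root : ∀ {s} (α : Fin s → Carrier) m k → 1 ≤ m k → eval (f α m) (α k) ≈ 0#
  f-root α m k 1≤mₖ = begin
    eval (f α m) (α k)                                  ≈⟨ eval-cong (α k) (f-factor α m k 1≤mₖ) ⟩
    eval (linear (α k) ⊗ f α (minusE α m k)) (α k)     ≈⟨ eval-⊗ (linear (α k)) (f α (minusE α m k)) (α k) ⟩
    eval (linear (α k)) (α k) * eval (f α (minusE α m k)) (α k) ≈⟨ *-congʳ (eval-linear-root (α k)) ⟩
    0# * eval (f α (minusE α m k)) (α k)               ≈⟨ zeroˡ _ ⟩
    0#                                                  ∎
    where open ≈-Reasoning

  deriv-f : ∀ {s} (α : Fin s → Carrier) m →
            deriv (f α m) ≋ sumPol s (λ i → scale (fromℕ (m i)) (f α (minusE α m i)))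
  deriv-f {zero}  α m = ≋-refl
  deriv-f {suc s} α m = begin
    deriv (g ⊗ f α′ m′)
      ≈⟨ deriv-⊗ g (f α′ m′) ⟩
    (deriv g ⊗ f α′ m′) ⊕ (g ⊗ deriv (f α′ m′))
      ≈⟨ ⊕-cong (≋-trans (⊗-congˡ (f α′ m′) (deriv-pow-linear (α zero) (m zero)))
                         (⊗-scaleˡ (fromℕ (m zero)) (pow (linear (α zero)) (m zero ∸ 1)) (f α′ m′)))
                (≋-trans (⊗-congʳ g (deriv-f α′ m′)) (⊗-sumPol g s _)) ⟩
    scale (fromℕ (m zero)) (pow (linear (α zero)) (m zero ∸ 1) ⊗ f α′ m′)
      ⊕ sumPol s (λ i → g ⊗ scale (fromℕ (m′ i)) (f α′ (minusE α′ m′ i)))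
      ≈⟨ ⊕-congˡ _ (sumPol-cong s (λ i → ⊗-scaleʳ (fromℕ (m′ i)) g _)) ⟩
    sumPol (suc s) (λ i → scale (fromℕ (m i)) (f α (minusE α m i)))
      ∎
    where
    open ≋-Reasoning
    α′ : Fin s → Carrier
    α′ i = α (suc i)
    m′ : Fin s → ℕ
    m′ i = m (suc i)
    g : Pol
    g = pow (linear (α zero)) (m zero)

  -- The recurrences for a_m

  derivSum-suc-f : ∀ {s} (α : Fin s → Carrier) N m →
    derivSum (suc N) (f α m) ≋ f α m ⊕ sumPol s (λ i → scale (fromℕ (m i)) (derivSum N (f α (minusE α m i))))
  derivSum-suc-f {s} α N m = begin
    derivSum (suc N) (f α m)
      ≈⟨ derivSum-suc N (f α m) ⟩
    f α m ⊕ derivSum N (deriv (f α m))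
      ≈⟨ ⊕-congˡ (f α m) (≋-trans (derivSum-cong N (deriv-f α m)) (derivSum-sumPol N s _)) ⟩
    f α m ⊕ sumPol s (λ i → derivSum N (scale (fromℕ (m i)) (f α (minusE α m i))))
      ≈⟨ ⊕-congˡ (f α m) (sumPol-cong s (λ i → derivSum-scale N (fromℕ (m i)) _)) ⟩
    f α m ⊕ sumPol s (λ i → scale (fromℕ (m i)) (derivSum N (f α (minusE α m i))))
      ∎
    where open ≋-Reasoning

  -- (z - αₗ) g = (z - αₖ) g + (αₖ - αₗ) g  with  g = f (m - eₖ).
  f-exchange : ∀ {s} (α : Fin s → Carrier) m k l → 1 ≤ m k →
               f α (plusE α (minusE α m k) l) ≋ f α m ⊕ scale (α k - α l) (f α (minusE α m k))
  f-exchange {s} α m k l 1≤mₖ = begin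
    f α (plusE α g l)
      ≈⟨ f-plusE α g l ⟩
    linear (α l) ⊗ f α g
      ≈⟨ ⊗-congˡ (f α g) (linear-change-root (α k) (α l)) ⟩
    (linear (α k) ⊕ ((α k - α l) ∷ [])) ⊗ f α g
      ≈⟨ ⊗-distribʳ (linear (α k)) ((α k - α l) ∷ []) (f α g) ⟩
    (linear (α k) ⊗ f α g) ⊕ (((α k - α l) ∷ []) ⊗ f α g)
      ≈⟨ ⊕-cong (≋-sym (f-factor α m k 1≤mₖ)) (constant-⊗ (α k - α l) (f α g)) ⟩
    f α m ⊕ scale (α k - α l) (f α g)
      ∎
    where
    open ≋-Reasoning
    g : Fin s → ℕ
    g = minusE α m k

  a-recurrence : ∀ {s} (α : Fin s → Carrier) n → (∀ i → 1 ≤ n i) →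
                 ∀ j → a α n j ≈ sum (λ i → fromℕ (n i) * a α (minusE α n i) j)
  a-recurrence {s} α n n≥1 j = begin
    a α n j
      ≡⟨ ≡.cong (λ M → eval (derivSum M (f α n)) x) (≡.sym (sumℕ-minusE α n j (n≥1 j))) ⟩
    eval (derivSum (suc N) (f α n)) x
      ≈⟨ eval-cong x (derivSum-suc-f α N n) ⟩
    eval (f α n ⊕ sumPol s T) x
      ≈⟨ eval-⊕ (f α n) (sumPol s T) x ⟩
    eval (f α n) x + eval (sumPol s T) x
      ≈⟨ +-cong (f-root α n j (n≥1 j)) (eval-sumPol s T x) ⟩
    0# + sum (λ i → eval (T i) x)
      ≈⟨ +-identityˡ _ ⟩
    sum (λ i → eval (T i) x)
      ≈⟨ sum-cong-≋ (λ i → trans (eval-scale (fromℕ (n i)) (derivSum N (f α (minusE α n i))) x) (*-congˡ (reflexive (lowered-a i)))) ⟩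
    sum (λ i → fromℕ (n i) * a α (minusE α n i) j)
      ∎
    where
    open ≈-Reasoning
    x : Carrier
    x = α j
    N : ℕ
    N = sumℕ s (minusE α n j)
    T : Fin s → Pol
    T i = scale (fromℕ (n i)) (derivSum N (f α (minusE α n i)))
    lowered-a : ∀ i → eval (derivSum N (f α (minusE α n i))) x ≡ a α (minusE α n i) j
    lowered-a i = ≡.cong (λ M → eval (derivSum M (f α (minusE α n i))) x)
      (ℕ.suc-injective (≡.trans (sumℕ-minusE α n j (n≥1 j)) (≡.sym (sumℕ-minusE α n i (n≥1 i)))))

  P-exchange : ∀ {s} (α : Fin s → Carrier) n k l → 1 ≤ n k →
               P α (plusE α (minusE α n k) l) ≋ P α n ⊕ scale (α k - α l) (P α (minusE α n k))
  P-exchange {s} α n k l 1≤nₖ = begin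
    derivSum (sumℕ s (plusE α g l)) (f α (plusE α g l))
      ≡⟨ ≡.cong (λ M → derivSum M (f α (plusE α g l))) (≡.trans (sumℕ-plusE α g l) (sumℕ-minusE α n k 1≤nₖ)) ⟩
    derivSum (sumℕ s n) (f α (plusE α g l))
      ≈⟨ derivSum-cong (sumℕ s n) (f-exchange α n k l 1≤nₖ) ⟩
    derivSum (sumℕ s n) (f α n ⊕ scale c (f α g))
      ≈⟨ ≋-trans (derivSum-⊕ (sumℕ s n) (f α n) _) (⊕-congˡ (P α n) (derivSum-scale (sumℕ s n) c (f α g))) ⟩
    P α n ⊕ scale c (derivSum (sumℕ s n) (f α g))
      ≡⟨ ≡.cong (λ M → P α n ⊕ scale c (derivSum M (f α g))) (≡.sym (sumℕ-minusE α n k 1≤nₖ)) ⟩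
    P α n ⊕ scale c (derivSum (suc (sumℕ s g)) (f α g))
      ≈⟨ ⊕-congˡ (P α n) (scale-cong refl (derivSum-truncate (sumℕ s g) (f α g) (ℕ.≤-reflexive (length-f α g)))) ⟩
    P α n ⊕ scale c (P α g)
      ∎
    where
    open ≋-Reasoning
    g : Fin s → ℕ
    g = minusE α n k
    c : Carrier
    c = α k - α l

  a-exchange : ∀ {s} (α : Fin s → Carrier) n k l → 1 ≤ n k →
               ∀ j → a α (minusE α (plusE α n l) k) j ≈ a α n j + (α k - α l) * a α (minusE α n k) j
  a-exchange α n k l 1≤nₖ j = begin
    a α (minusE α (plusE α n l) k) j
      ≡⟨ a-cong α (minusE-plusE α n k l 1≤nₖ) j ⟩
    eval (P α (plusE α (minusE α n k) l)) (α j)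
      ≈⟨ eval-cong (α j) (P-exchange α n k l 1≤nₖ) ⟩
    eval (P α n ⊕ scale (α k - α l) (P α (minusE α n k))) (α j)
      ≈⟨ eval-⊕ (P α n) _ (α j) ⟩
    a α n j + eval (scale (α k - α l) (P α (minusE α n k))) (α j)
      ≈⟨ +-congˡ (eval-scale (α k - α l) (P α (minusE α n k)) (α j)) ⟩
    a α n j + (α k - α l) * a α (minusE α n k) j
      ∎
    where open ≈-Reasoning

mainTheorem17 : {c ℓ : Level} (R : CommutativeRing c ℓ) (s : ℕ)
    (α : Fin s → CommutativeRing.Carrier R) →
    (∀ i j → i ≢ j → ¬ CommutativeRing._≈_ R (α i) (α j)) →
    (n : Fin s → ℕ) → (∀ i → 1 ≤ n i) → (l : Fin s) →
    ∀ k j → CommutativeRing._≈_ R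
    (Poly.A R α (Poly.plusE R α n l) k j)
    (Poly.matMul R (Poly.Mat R α n l) (Poly.A R α n) k j)
-- The αᵢ need not be distinct for this identity.
mainTheorem17 R s α _ n n≥1 l k j = begin
  a α (minusE α (plusE α n l) k) j
    ≈⟨ a-exchange α n k l (n≥1 k) j ⟩
  a α n j + c * aᵢ k
    ≈⟨ +-cong (a-recurrence α n n≥1 j) (sym (sum-δ α k (λ i → c * aᵢ i))) ⟩
  sum (λ i → fromℕ (n i) * aᵢ i) + sum (λ i → δ α k i * (c * aᵢ i))
    ≈⟨ sym (∑-distrib-+ (λ i → fromℕ (n i) * aᵢ i) (λ i → δ α k i * (c * aᵢ i))) ⟩
  sum (λ i → fromℕ (n i) * aᵢ i + δ α k i * (c * aᵢ i))
    ≈⟨ sum-cong-≋ (λ i → sym (trans (distribʳ (aᵢ i) _ _) (+-congˡ (*-assoc _ _ _)))) ⟩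
  sum (λ i → Mat α n l k i * aᵢ i)
    ≡⟨ sumFin≡sum s (λ i → Mat α n l k i * aᵢ i) ⟨
  matMul (Mat α n l) (A α n) k j
    ∎
  where
  open CommutativeRing R hiding (zero)
  open Poly R
  open Polynomials R
  open SemiringSum semiring using (sum; sum-cong-≋; ∑-distrib-+)
  open SetoidReasoning setoid
  c : Carrier
  c = α k - α l
  aᵢ : Fin s → Carrier
  aᵢ i = a α (minusE α n i) j
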